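{- Let $\mathbf A=\langle A,+,',1\rangle$ be a 0-commutative orthogroupoid and $e$ a central element of $\mathbf A$. Then $\mathbf A\cong[\mathbf 0,\mathbf e]\times[\mathbf 0,\mathbf e']$, where for a central element $c$, $[\mathbf 0,\mathbf c]$ denotes the algebra $\langle[0,c],+,{}^{c},c\rangle$ with universe $[0,c]=\{x\in A:x+c=c+x=c\}$, binary operation the restriction of $+$, unary operation $x^{c}=c\cdot x'$, and constant $c$.
   Context: An orthogroupoid is an algebra $\langle A,+,',1\rangle$ of type $(2,1,0)$, with $0:=1'$, satisfying: (a) $x''\approx x$; (b) $0+x\approx x$ and $x+1\approx 1$; (c) $x+x'\approx 1$; (d) for all $x,z$: if $x+z=z$ and $x'+z=z$ then $z=1$; (e) $(((z+y)'+(z+x))'+(z+y)')+z'\approx z'$; (f) $x+(x+y)\approx x+y$ and $y+(x+y)\approx x+y$. It is 0-commutative if it satisfies $x+0\approx 0+x$. Define $x\cdot y:=(x'+y')'$. An element $e\in A$ is central if the principal congruences $\theta(e,0)$ and $\theta(e,1)$ form a pair of factor congruences of $\mathbf A$ (their intersection is the identity relation and their composition is $A\times A$). -}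

module Defs where

open import Level using (Level; suc; _⊔_)
open import Data.Product using (Σ; ∃; _×_; _,_; proj₁; proj₂)
open import Relation.Binary.PropositionalEquality using (_≡_)

record Orthogroupoid (ℓ : Level) : Set (suc ℓ) where
  infixl 6 _+_
  infix  8 _′
  field
    Carrier : Set ℓ
    _+_     : Carrier → Carrier → Carrier
    _′      : Carrier → Carrier
    𝟙       : Carrier

  𝟘 : Carrier
  𝟘 = 𝟙 ′

  field
    involutive : ∀ x → (x ′) ′ ≡ x
    zero-left  : ∀ x → 𝟘 + x ≡ x
    one-right  : ∀ x → x + 𝟙 ≡ 𝟙
    compl      : ∀ x → x + x ′ ≡ 𝟙
    quasi      : ∀ x z → x + z ≡ z → x ′ + z ≡ z → z ≡ 𝟙
    axiom-e    : ∀ x y z → ((((z + y) ′ + (z + x)) ′) + (z + y) ′) + z ′ ≡ z ′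
    absorb-l   : ∀ x y → x + (x + y) ≡ x + y
    absorb-r   : ∀ x y → y + (x + y) ≡ x + y

  _·_ : Carrier → Carrier → Carrier
  x · y = (x ′ + y ′) ′

ZeroCommutative : ∀ {ℓ} → Orthogroupoid ℓ → Set ℓ
ZeroCommutative A = ∀ x → x + 𝟘 ≡ 𝟘 + x
  where open Orthogroupoid A

module _ {ℓ : Level} (A : Orthogroupoid ℓ) where
  open Orthogroupoid A

  Rel : Set (suc ℓ)
  Rel = Carrier → Carrier → Set ℓ

  record IsCongruence (R : Rel) : Set ℓ where
    field
      refl′  : ∀ x → R x x
      sym′   : ∀ {x y} → R x y → R y x
      trans′ : ∀ {x y z} → R x y → R y z → R x z
      +-cong : ∀ {x x₁ y y₁} → R x x₁ → R y y₁ → R (x + y) (x₁ + y₁)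
      ′-cong : ∀ {x y} → R x y → R (x ′) (y ′)

  θ : Carrier → Carrier → Carrier → Carrier → Set (suc ℓ)
  θ a b x y = (R : Rel) → IsCongruence R → R a b → R x y

  -- A pair of (generalised) relations are factor congruences: both are
  -- congruences (principal congruences always are), their intersection is
  -- the identity and their composition is A × A.
  IsFactorPair : (Carrier → Carrier → Set (suc ℓ)) → (Carrier → Carrier → Set (suc ℓ)) → Set (suc ℓ)
  IsFactorPair φ ψ =
      (∀ x y → φ x y → ψ x y → x ≡ y)
    × (∀ x y → Σ Carrier λ z → φ x z × ψ z y)

  Central : Carrier → Set (suc ℓ)
  Central e = IsFactorPair (θ e 𝟘) (θ e 𝟙)

  InInterval : Carrier → Carrier → Set ℓ
  InInterval c x = (x + c ≡ c) × (c + x ≡ c)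

  _^[_] : Carrier → Carrier → Carrier
  x ^[ c ] = c · (x ′)

  -- An isomorphism A ≅ [0,c] × [0,d] (algebras ⟨[0,c],+,^c,c⟩ and
  -- ⟨[0,d],+,^d,d⟩, product taken componentwise), presented as a map
  -- f = ⟨f₁,f₂⟩ : A → A × A landing in [0,c] × [0,d], preserving +, the
  -- unary operation and the constant, injective and onto [0,c] × [0,d].
  record IntervalProductIso (c d : Carrier) : Set ℓ where
    field
      f₁ f₂   : Carrier → Carrier
      into₁   : ∀ x → InInterval c (f₁ x)
      into₂   : ∀ x → InInterval d (f₂ x)
      hom+₁   : ∀ x y → f₁ (x + y) ≡ f₁ x + f₁ y
      hom+₂   : ∀ x y → f₂ (x + y) ≡ f₂ x + f₂ y
      hom′₁   : ∀ x → f₁ (x ′) ≡ (f₁ x) ^[ c ]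
      hom′₂   : ∀ x → f₂ (x ′) ≡ (f₂ x) ^[ d ]
      hom𝟙₁   : f₁ 𝟙 ≡ c
      hom𝟙₂   : f₂ 𝟙 ≡ d
      injective : ∀ x y → f₁ x ≡ f₁ y → f₂ x ≡ f₂ y → x ≡ y
      surjective : ∀ a b → InInterval c a → InInterval d b →
                   Σ Carrier λ x → (f₁ x ≡ a) × (f₂ x ≡ b)

-- Since θ(e,0) and θ(e,1) are factor congruences, every x is determined by
-- its classes modulo θ(e,0) and modulo θ(e,1), and every pair of classes is
-- realised.  The component of x in [0,e] is the element that is 0 modulo
-- θ(e,0) and x modulo θ(e,1); every required equation is checked separately
-- modulo each congruence, where e collapses to 0 or to 1 and the interval
-- operations become those of A.  As θ(e′,0) = θ(e,1) and θ(e′,1) = θ(e,0),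
-- e′ is central as well, and the component in [0,e′] is the same
-- construction for e′.  Zero-commutativity is needed only to see that an
-- element a of [0,e] is 0 modulo θ(e,0), via a = a + 0 ≡ a + e = e.
module Submission where

open import Level using (Level; suc)
open import Data.Product using (Σ; _×_; _,_; proj₁; proj₂)
open import Relation.Binary.Bundles using (Setoid)
open import Relation.Binary.Structures using (IsEquivalence)
open import Relation.Binary.PropositionalEquality using (_≡_; sym; cong; subst; subst₂)
import Relation.Binary.Reasoning.Setoid as SetoidReasoning
open import Defs

module _ {ℓ : Level} (A : Orthogroupoid ℓ) where
  open Orthogroupoid A

  one-left : ∀ x → 𝟙 + x ≡ 𝟙
  one-left x = quasi 𝟙 (𝟙 + x) (absorb-l 𝟙 x) (zero-left (𝟙 + x))

  zero-right : ZeroCommutative A → ∀ x → x + 𝟘 ≡ x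
  zero-right zc x = subst (x + 𝟘 ≡_) (zero-left x) (zc x)

  module PrincipalCongruence (a b : Carrier) where
    isEquivalence : IsEquivalence (θ A a b)
    isEquivalence = record
      { refl  = λ {x} R R-cong _ → IsCongruence.refl′ R-cong x
      ; sym   = λ p R R-cong Rab → IsCongruence.sym′ R-cong (p R R-cong Rab)
      ; trans = λ p q R R-cong Rab → IsCongruence.trans′ R-cong (p R R-cong Rab) (q R R-cong Rab)
      }

    setoid : Setoid ℓ (suc ℓ)
    setoid = record { isEquivalence = isEquivalence }

    open IsEquivalence isEquivalence public

    +-cong : ∀ {x x₁ y y₁} → θ A a b x x₁ → θ A a b y y₁ → θ A a b (x + y) (x₁ + y₁)
    +-cong p q R R-cong Rab = IsCongruence.+-cong R-cong (p R R-cong Rab) (q R R-cong Rab)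

    ′-cong : ∀ {x y} → θ A a b x y → θ A a b (x ′) (y ′)
    ′-cong p R R-cong Rab = IsCongruence.′-cong R-cong (p R R-cong Rab)

    generators : θ A a b a b
    generators _ _ Rab = Rab

  θ-′⇒θ : ∀ {a b x y} → θ A (a ′) (b ′) x y → θ A a b x y
  θ-′⇒θ p R R-cong Rab = p R R-cong (IsCongruence.′-cong R-cong Rab)

  θ⇒θ-′ : ∀ {a b x y} → θ A a b x y → θ A (a ′) (b ′) x y
  θ⇒θ-′ {a} {b} p R R-cong Ra′b′ =
    p R R-cong (subst₂ R (involutive a) (involutive b) (IsCongruence.′-cong R-cong Ra′b′))

  central-′ : ∀ {c} → Central A c → Central A (c ′)
  central-′ {c} (separate , compose) =
      (λ x y p q → separate x y (θ-′𝟙⇒θ𝟘 q) (θ-′⇒θ p))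
    , λ x y → let (z , yφz , zψx) = compose y x in
              z , θ⇒θ-′ (ψ.sym zψx) , θ𝟘⇒θ-′𝟙 (φ.sym yφz)
    where
    module φ = PrincipalCongruence c 𝟘
    module ψ = PrincipalCongruence c 𝟙

    θ-′𝟙⇒θ𝟘 : ∀ {x y} → θ A (c ′) 𝟙 x y → θ A c 𝟘 x y
    θ-′𝟙⇒θ𝟘 {x} {y} p = θ-′⇒θ (subst (λ v → θ A (c ′) v x y) (sym (involutive 𝟙)) p)

    θ𝟘⇒θ-′𝟙 : ∀ {x y} → θ A c 𝟘 x y → θ A (c ′) 𝟙 x y
    θ𝟘⇒θ-′𝟙 {x} {y} p = subst (λ v → θ A (c ′) v x y) (involutive 𝟙) (θ⇒θ-′ p)

  module Component (c : Carrier) (central : Central A c) where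
    module φ = PrincipalCongruence c 𝟘
    module ψ = PrincipalCongruence c 𝟙
    module φ-Reasoning = SetoidReasoning φ.setoid
    module ψ-Reasoning = SetoidReasoning ψ.setoid

    ≡-from-factors : ∀ {x y} → θ A c 𝟘 x y → θ A c 𝟙 x y → x ≡ y
    ≡-from-factors = proj₁ central _ _

    component : Carrier → Carrier
    component x = proj₁ (proj₂ central 𝟘 x)

    component-φ : ∀ x → θ A c 𝟘 (component x) 𝟘
    component-φ x = φ.sym (proj₁ (proj₂ (proj₂ central 𝟘 x)))

    component-ψ : ∀ x → θ A c 𝟙 (component x) x
    component-ψ x = proj₂ (proj₂ (proj₂ central 𝟘 x))

    component-unique : ∀ {a x} → θ A c 𝟘 a 𝟘 → θ A c 𝟙 a x → component x ≡ a
    component-unique {x = x} a≈𝟘 a≈x =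
      ≡-from-factors (φ.trans (component-φ x) (φ.sym a≈𝟘)) (ψ.trans (component-ψ x) (ψ.sym a≈x))

    interval⇒φ-𝟘 : ZeroCommutative A → ∀ {a} → InInterval A c a → θ A c 𝟘 a 𝟘
    interval⇒φ-𝟘 zc {a} (a+c≡c , _) = begin
      a      ≡⟨ zero-right zc a ⟨
      a + 𝟘  ≈⟨ φ.+-cong φ.refl (φ.sym φ.generators) ⟩
      a + c  ≡⟨ a+c≡c ⟩
      c      ≈⟨ φ.generators ⟩
      𝟘      ∎
      where open φ-Reasoning

    component-interval : ∀ x → InInterval A c (component x)
    component-interval x =
        ≡-from-factors (φ.trans (φ.+-cong (component-φ x) φ.refl) (φ.reflexive (zero-left c)))
                       right-absorbs-ψ
      , ≡-from-factors left-absorbs-φ left-absorbs-ψ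
      where
      right-absorbs-ψ : θ A c 𝟙 (component x + c) c
      right-absorbs-ψ = begin
        component x + c  ≈⟨ ψ.+-cong (component-ψ x) ψ.generators ⟩
        x + 𝟙            ≡⟨ one-right x ⟩
        𝟙                ≈⟨ ψ.generators ⟨
        c                ∎
        where open ψ-Reasoning

      left-absorbs-φ : θ A c 𝟘 (c + component x) c
      left-absorbs-φ = begin
        c + component x  ≈⟨ φ.+-cong φ.generators (component-φ x) ⟩
        𝟘 + 𝟘            ≡⟨ zero-left 𝟘 ⟩
        𝟘                ≈⟨ φ.generators ⟨
        c                ∎
        where open φ-Reasoning

      left-absorbs-ψ : θ A c 𝟙 (c + component x) c
      left-absorbs-ψ = begin
        c + component x  ≈⟨ ψ.+-cong ψ.generators (component-ψ x) ⟩
        𝟙 + x            ≡⟨ one-left x ⟩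
        𝟙                ≈⟨ ψ.generators ⟨
        c                ∎
        where open ψ-Reasoning

    component-+ : ∀ x y → component (x + y) ≡ component x + component y
    component-+ x y = component-unique
      (φ.trans (φ.+-cong (component-φ x) (component-φ y)) (φ.reflexive (zero-left 𝟘)))
      (ψ.+-cong (component-ψ x) (component-ψ y))

    component-′ : ∀ x → component (x ′) ≡ _^[_] A (component x) c
    component-′ x = component-unique complement-φ complement-ψ
      where
      complement-φ : θ A c 𝟘 ((c ′ + component x ′ ′) ′) 𝟘
      complement-φ = begin
        (c ′ + component x ′ ′) ′  ≈⟨ φ.′-cong (φ.+-cong (φ.′-cong φ.generators) φ.refl) ⟩
        (𝟘 ′ + component x ′ ′) ′  ≡⟨ cong (λ u → (u + component x ′ ′) ′) (involutive 𝟙) ⟩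
        (𝟙 + component x ′ ′) ′    ≡⟨ cong _′ (one-left (component x ′ ′)) ⟩
        𝟘                          ∎
        where open φ-Reasoning

      complement-ψ : θ A c 𝟙 ((c ′ + component x ′ ′) ′) (x ′)
      complement-ψ = begin
        (c ′ + component x ′ ′) ′  ≈⟨ ψ.′-cong (ψ.+-cong (ψ.′-cong ψ.generators) (ψ.′-cong (ψ.′-cong (component-ψ x)))) ⟩
        (𝟘 + x ′ ′) ′              ≡⟨ cong _′ (zero-left (x ′ ′)) ⟩
        x ′ ′ ′                    ≡⟨ involutive (x ′) ⟩
        x ′                        ∎
        where open ψ-Reasoning

    component-𝟙 : component 𝟙 ≡ c
    component-𝟙 = component-unique φ.generators ψ.generators

    component-≡⇒ψ : ∀ {x y} → component x ≡ component y → θ A c 𝟙 x y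
    component-≡⇒ψ {x} {y} p = ψ.trans (ψ.sym (component-ψ x)) (ψ.trans (ψ.reflexive p) (component-ψ y))

  module Decomposition (zc : ZeroCommutative A) (e : Carrier) (central : Central A e) where
    central′ : Central A (e ′)
    central′ = central-′ central

    module E  = Component e central
    module E′ = Component (e ′) central′

    components-injective : ∀ x y → E.component x ≡ E.component y → E′.component x ≡ E′.component y → x ≡ y
    components-injective x y p q = proj₁ central′ x y (θ⇒θ-′ (E.component-≡⇒ψ p)) (E′.component-≡⇒ψ q)

    components-surjective : ∀ a b → InInterval A e a → InInterval A (e ′) b →
                            Σ Carrier λ x → (E.component x ≡ a) × (E′.component x ≡ b)
    components-surjective a b a∈[0,e] b∈[0,e′] =
      let (x , a≈x , x≈b) = proj₂ central′ a b in
      x , E.component-unique (E.interval⇒φ-𝟘 zc a∈[0,e]) (θ-′⇒θ a≈x)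
        , E′.component-unique (E′.interval⇒φ-𝟘 zc b∈[0,e′]) (E′.ψ.sym x≈b)

theorem3p8 : ∀ {ℓ : Level} (A : Orthogroupoid ℓ) → ZeroCommutative A →
             (e : Orthogroupoid.Carrier A) → Central A e →
             IntervalProductIso A e (Orthogroupoid._′ A e)
theorem3p8 A zc e central = record
  { f₁ = E.component ; f₂ = E′.component
  ; into₁ = E.component-interval ; into₂ = E′.component-interval
  ; hom+₁ = E.component-+ ; hom+₂ = E′.component-+
  ; hom′₁ = E.component-′ ; hom′₂ = E′.component-′
  ; hom𝟙₁ = E.component-𝟙 ; hom𝟙₂ = E′.component-𝟙
  ; injective = components-injective
  ; surjective = components-surjective
  }
  where open Decomposition A zc e central
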